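{- Let $p$ be a prime with $p\equiv 1\pmod{12}$. Then there exists a reflexible map $\mathcal{M}$ of type $\{3,p\}$ with automorphism group ${\rm PSL}_2(p)$ admitting a reflexible non-orientable extension $\bar{\mathcal{M}}$ with ${\rm Aut}(\bar{\mathcal{M}})\cong{\rm PSL}_2(p)$. Moreover, $\bar{\mathcal{M}}$ belongs to Class 1, i.e. writing $\bar{\mathcal{M}}=(G,(\rho_0,\rho_1,\rho_2,\rho_3))$, both $\langle\rho_1,\rho_2,\rho_3\rangle$ and $\langle\rho_0,\rho_1,\rho_2\rangle$ are equal to $G$.
   Context: A string representation of rank $n$ of a group $G$ is an $n$-tuple $(\rho_0,\ldots,\rho_{n-1})$ of pairwise distinct involutions generating $G$ with $\rho_i\rho_j=\rho_j\rho_i$ whenever $|i-j|>1$. A reflexible $n$-maniplex with automorphism group $G$ is identified with a pair $(G,(\rho_0,\ldots,\rho_{n-1}))$ where $(\rho_i)$ is a string representation of $G$ (flags are the elements of $G$, the distinguished involutions act by left multiplication by $\rho_i$, automorphisms act by right multiplication). A map is a maniplex of rank $3$; the type of a reflexible map $(G,(\rho_0,\rho_1,\rho_2))$ is $\{\sigma_0,\sigma_1\}$ where $\sigma_0,\sigma_1$ are the orders of $\rho_0\rho_1$ and $\rho_1\rho_2$. A reflexible $4$-maniplex $(G,(\rho_0,\ldots,\rho_3))$ is an extension of a reflexible map $\mathcal{M}$ if all its facets are isomorphic to $\mathcal{M}$; the facets of $(G,(\rho_0,\ldots,\rho_3))$ are all isomorphic to the reflexible map $(\langle\rho_0,\rho_1,\rho_2\rangle,(\rho_0,\rho_1,\rho_2))$,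 and two reflexible maniplexes given by string representations are isomorphic iff some group isomorphism maps the distinguished generators of one to those of the other in order. A reflexible maniplex $(G,(\rho_i))$ is non-orientable if the subgroup generated by all products $\rho_i\rho_j$ is all of $G$ (and orientable if it has index $2$). -}

module Defs where

open import Data.Nat as ℕ using (ℕ; zero; suc; _<_; _≤_)
open import Data.Integer as ℤ using (ℤ; +_; _-_; -_)
open import Data.Integer.Divisibility using (_∣_)
open import Data.Product using (_×_; Σ; ∃)
open import Data.Sum using (_⊎_)
open import Data.List using (List; []; _∷_)
open import Data.List.Relation.Unary.Any using (Any)
open import Relation.Nullary using (¬_)

-- 2×2 integer matrices [[a , b] , [c , d]]; entries are read modulo p.
record Mat : Set where
  constructor mat
  field a b c d : ℤ
open Mat public

-- matrix product, identity, adjugate (= inverse for determinant-1 matrices)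
_·_ : Mat → Mat → Mat
mat a₁ b₁ c₁ d₁ · mat a₂ b₂ c₂ d₂ =
  mat (a₁ ℤ.* a₂ ℤ.+ b₁ ℤ.* c₂) (a₁ ℤ.* b₂ ℤ.+ b₁ ℤ.* d₂)
      (c₁ ℤ.* a₂ ℤ.+ d₁ ℤ.* c₂) (c₁ ℤ.* b₂ ℤ.+ d₁ ℤ.* d₂)

I : Mat
I = mat (+ 1) (+ 0) (+ 0) (+ 1)

_⁻¹ : Mat → Mat
mat a b c d ⁻¹ = mat d (- b) (- c) a

det : Mat → ℤ
det (mat a b c d) = a ℤ.* d - b ℤ.* c

_^_ : Mat → ℕ → Mat
g ^ zero = I
g ^ suc n = g · (g ^ n)

module _ (p : ℕ) where

  _≡ₚ_ : ℤ → ℤ → Set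
  x ≡ₚ y = (+ p) ∣ (x - y)

  InSL : Mat → Set
  InSL g = det g ≡ₚ (+ 1)

  -- equality in PSL₂(p) = SL₂(p)/{±I}
  _≈_ : Mat → Mat → Set
  g ≈ h = (a g ≡ₚ a h × b g ≡ₚ b h × c g ≡ₚ c h × d g ≡ₚ d h)
        ⊎ (a g ≡ₚ (- a h) × b g ≡ₚ (- b h) × c g ≡ₚ (- c h) × d g ≡ₚ (- d h))

  HasOrder : Mat → ℕ → Set
  HasOrder g n = 1 ≤ n × (g ^ n) ≈ I × (∀ m → 1 ≤ m → m < n → ¬ ((g ^ m) ≈ I))

  data ⟨_⟩ (S : List Mat) : Mat → Set where
    gen  : ∀ {x} → Any (x ≈_) S → ⟨ S ⟩ x
    one  : ⟨ S ⟩ I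
    mul  : ∀ {x y} → ⟨ S ⟩ x → ⟨ S ⟩ y → ⟨ S ⟩ (x · y)
    inv  : ∀ {x} → ⟨ S ⟩ x → ⟨ S ⟩ (x ⁻¹)
    resp : ∀ {x y} → x ≈ y → ⟨ S ⟩ x → ⟨ S ⟩ y

  Generates : List Mat → Set
  Generates S = ∀ x → InSL x → ⟨ S ⟩ x

  IsStringRep4 : Mat → Mat → Mat → Mat → Set
  IsStringRep4 ρ₀ ρ₁ ρ₂ ρ₃ =
      (InSL ρ₀ × InSL ρ₁ × InSL ρ₂ × InSL ρ₃)
    × (HasOrder ρ₀ 2 × HasOrder ρ₁ 2 × HasOrder ρ₂ 2 × HasOrder ρ₃ 2)
    × (¬ ρ₀ ≈ ρ₁ × ¬ ρ₀ ≈ ρ₂ × ¬ ρ₀ ≈ ρ₃ × ¬ ρ₁ ≈ ρ₂ × ¬ ρ₁ ≈ ρ₃ × ¬ ρ₂ ≈ ρ₃)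
    × ((ρ₀ · ρ₂) ≈ (ρ₂ · ρ₀) × (ρ₀ · ρ₃) ≈ (ρ₃ · ρ₀) × (ρ₁ · ρ₃) ≈ (ρ₃ · ρ₁))
    × Generates (ρ₀ ∷ ρ₁ ∷ ρ₂ ∷ ρ₃ ∷ [])

  -- non-orientable: the products ρᵢρⱼ generate the whole group
  NonOrientable4 : Mat → Mat → Mat → Mat → Set
  NonOrientable4 ρ₀ ρ₁ ρ₂ ρ₃ =
    Generates ( (ρ₀ · ρ₁) ∷ (ρ₀ · ρ₂) ∷ (ρ₀ · ρ₃) ∷ (ρ₁ · ρ₀) ∷ (ρ₁ · ρ₂) ∷ (ρ₁ · ρ₃)
              ∷ (ρ₂ · ρ₀) ∷ (ρ₂ · ρ₁) ∷ (ρ₂ · ρ₃) ∷ (ρ₃ · ρ₀) ∷ (ρ₃ · ρ₁) ∷ (ρ₃ · ρ₂) ∷ [])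

-- Choose i and x with i² ≡ −1 and 3x² ≡ 1 (mod p); they exist because 4 and 3 divide p − 1: by
-- Fermat's little theorem a^(p−1) ≡ 1 for every unit a, while a finite-difference argument (the m-th
-- difference of y^m − 1 is m!, which p does not divide) shows that a^((p−1)/2) and a^((p−1)/3) are
-- not 1 for all small a. Then ρ₀ = i[−1 0; 1 1], ρ₁ = i[1 1; 0 −1], ρ₂ = i[−1 −2; 0 1] and
-- ρ₃ = x[1 2; −2 −1] are involutions of PSL₂(p) commuting as a string group requires, ρ₀ρ₁ has
-- order 3 and ρ₁ρ₂ = [1 1; 0 1] has order p. A subgroup of PSL₂(p) containing [1 1; 0 1] and an
-- element with invertible lower-left entry contains all upper and, by conjugation, all lower
-- unipotent matrices, hence everything. Applied to ⟨ρ₀, ρ₁, ρ₂⟩, to ⟨ρ₁, ρ₂, ρ₃⟩ and to the subgroup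
-- generated by the products ρᵢρⱼ this gives the generation statements, the last one being
-- non-orientability.

{-# OPTIONS --safe #-}
module Submission where

open import Data.Nat.Base as ℕ using (ℕ; zero; suc; _%_; _/_; _∸_; _!; z≤n; s≤s)
open import Data.Nat.DivMod using (m≡m%n+[m/n]*n)
import Data.Nat.Properties as ℕ
import Data.Nat.Divisibility as ℕ
open import Data.Nat.Primality using (Prime; euclidsLemma; prime⇒nonZero; prime⇒nonTrivial)
open import Data.Integer.Base as ℤ using (ℤ; +_; -[1+_]; _+_; _*_; _-_; -_)
import Data.Integer.Properties as ℤ
open import Data.Integer.Divisibility.Signed
  using (_∣_; divides; ∣ᵤ⇒∣; ∣⇒∣ᵤ; ∣m∣n⇒∣m+n; ∣n⇒∣m*n; ∣m⇒∣m*n; ∣m⇒∣-m; ∣m∣n⇒∣m-n; ∣-refl; _∣?_)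
open import Data.Integer.Tactic.RingSolver using (solve-∀)
open import Data.Product using (_×_; _,_; ∃; proj₁; proj₂)
open import Data.Sum using (_⊎_; inj₁; inj₂; [_,_]′)
open import Data.List using (List; []; _∷_)
open import Data.Empty using (⊥-elim)
open import Function.Base using (_∘_)
open import Relation.Nullary using (¬_; Dec; yes; no)
open import Relation.Nullary.Decidable using (map′)
open import Relation.Binary.PropositionalEquality hiding (resp)
open import Relation.Binary.Bundles using (Setoid)
import Relation.Binary.Reasoning.Setoid as SetoidReasoning
open import Defs using (Mat)

module Congruence (p : ℕ) (p-prime : Prime p) where

  1<p : 1 ℕ.< p
  1<p = ℕ.nonTrivial⇒n>1 p ⦃ prime⇒nonTrivial p-prime ⦄

  infix 4 _≋_
  record _≋_ (x y : ℤ) : Set where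
    constructor congruent
    field divides-difference : + p ∣ x - y
  open _≋_ public

  ∣-by : ∀ {x y} → x ≡ y → + p ∣ x → + p ∣ y
  ∣-by = subst (+ p ∣_)

  ≋-by : ∀ {x y} e → e ≡ x - y → + p ∣ e → x ≋ y
  ≋-by e eq p∣e = congruent (∣-by eq p∣e)

  p∣0 : + p ∣ + 0
  p∣0 = divides (+ 0) refl

  ≋-refl : ∀ {x} → x ≋ x
  ≋-refl {x} = ≋-by (+ 0) (sym (ℤ.+-inverseʳ x)) p∣0

  ≡⇒≋ : ∀ {x y} → x ≡ y → x ≋ y
  ≡⇒≋ refl = ≋-refl

  ≋-sym : ∀ {x y} → x ≋ y → y ≋ x
  ≋-sym {x} {y} (congruent p∣x-y) = ≋-by (- (x - y)) (eq x y) (∣m⇒∣-m p∣x-y)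
    where eq : ∀ x y → - (x - y) ≡ y - x
          eq = solve-∀

  ≋-trans : ∀ {x y z} → x ≋ y → y ≋ z → x ≋ z
  ≋-trans {x} {y} {z} (congruent p∣x-y) (congruent p∣y-z) =
    ≋-by ((x - y) + (y - z)) (eq x y z) (∣m∣n⇒∣m+n p∣x-y p∣y-z)
    where eq : ∀ x y z → (x - y) + (y - z) ≡ x - z
          eq = solve-∀

  ≋-setoid : Setoid _ _
  ≋-setoid = record
    { Carrier = ℤ
    ; _≈_ = _≋_
    ; isEquivalence = record { refl = ≋-refl ; sym = ≋-sym ; trans = ≋-trans }
    }

  +-cong : ∀ {x x′ y y′} → x ≋ x′ → y ≋ y′ → x + y ≋ x′ + y′
  +-cong {x} {x′} {y} {y′} (congruent p∣x) (congruent p∣y) =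
    ≋-by ((x - x′) + (y - y′)) (eq x x′ y y′) (∣m∣n⇒∣m+n p∣x p∣y)
    where eq : ∀ x x′ y y′ → (x - x′) + (y - y′) ≡ (x + y) - (x′ + y′)
          eq = solve-∀

  *-cong : ∀ {x x′ y y′} → x ≋ x′ → y ≋ y′ → x * y ≋ x′ * y′
  *-cong {x} {x′} {y} {y′} (congruent p∣x) (congruent p∣y) =
    ≋-by (y * (x - x′) + x′ * (y - y′)) (eq x x′ y y′) (∣m∣n⇒∣m+n (∣n⇒∣m*n y p∣x) (∣n⇒∣m*n x′ p∣y))
    where eq : ∀ x x′ y y′ → y * (x - x′) + x′ * (y - y′) ≡ x * y - x′ * y′
          eq = solve-∀

  -‿cong : ∀ {x y} → x ≋ y → - x ≋ - y
  -‿cong {x} {y} (congruent p∣x-y) = ≋-by (- (x - y)) (eq x y) (∣m⇒∣-m p∣x-y)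
    where eq : ∀ x y → - (x - y) ≡ - x - - y
          eq = solve-∀

  ≋-by-multiple : ∀ {x y u} A → x - y ≡ A * u → + p ∣ u → x ≋ y
  ≋-by-multiple {x} {y} {u} A eq p∣u = ≋-by (A * u) (sym eq) (∣n⇒∣m*n A p∣u)

  ≋-by-combination : ∀ {x y u v} A B → x - y ≡ A * u + B * v → + p ∣ u → + p ∣ v → x ≋ y
  ≋-by-combination {x} {y} {u} {v} A B eq p∣u p∣v =
    ≋-by (A * u + B * v) (sym eq) (∣m∣n⇒∣m+n (∣n⇒∣m*n A p∣u) (∣n⇒∣m*n B p∣v))

  ≋-dec : ∀ x y → Dec (x ≋ y)
  ≋-dec x y = map′ congruent divides-difference (+ p ∣? x - y)

  ∣⇒≋0 : ∀ {x} → + p ∣ x → x ≋ + 0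
  ∣⇒≋0 {x} p∣x = ≋-by x (sym (ℤ.+-identityʳ x)) p∣x

  ≋0⇒∣ : ∀ {x} → x ≋ + 0 → + p ∣ x
  ≋0⇒∣ {x} (congruent p∣x-0) = ∣-by (ℤ.+-identityʳ x) p∣x-0

  euclid : ∀ x y → + p ∣ x * y → + p ∣ x ⊎ + p ∣ y
  euclid x y p∣xy
    with euclidsLemma ℤ.∣ x ∣ ℤ.∣ y ∣ p-prime (subst (p ℕ.∣_) (ℤ.abs-* x y) (∣⇒∣ᵤ p∣xy))
  ... | inj₁ p∣x = inj₁ (∣ᵤ⇒∣ p∣x)
  ... | inj₂ p∣y = inj₂ (∣ᵤ⇒∣ p∣y)

  cancelˡ : ∀ {x y} → ¬ + p ∣ x → + p ∣ x * y → + p ∣ y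
  cancelˡ {x} {y} x≢0 p∣xy with euclid x y p∣xy
  ... | inj₁ p∣x = ⊥-elim (x≢0 p∣x)
  ... | inj₂ p∣y = p∣y

  cancelˡ-≋ : ∀ {x y z} → ¬ + p ∣ x → x * y ≋ x * z → y ≋ z
  cancelˡ-≋ {x} {y} {z} x≢0 (congruent p∣xy-xz) = congruent (cancelˡ x≢0 (∣-by (eq x y z) p∣xy-xz))
    where eq : ∀ x y z → x * y - x * z ≡ x * (y - z)
          eq = solve-∀

  unit-* : ∀ {x y} → ¬ + p ∣ x → ¬ + p ∣ y → ¬ + p ∣ x * y
  unit-* x≢0 y≢0 p∣xy = y≢0 (cancelˡ x≢0 p∣xy)

  unit-neg : ∀ {x} → ¬ + p ∣ x → ¬ + p ∣ - x
  unit-neg {x} x≢0 p∣-x = x≢0 (∣-by (ℤ.neg-involutive x) (∣m⇒∣-m p∣-x))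

  small-unit : ∀ {n} → 0 ℕ.< n → n ℕ.< p → ¬ + p ∣ + n
  small-unit 0<n n<p p∣n = ℕ.<⇒≱ n<p (ℕ.∣⇒≤ ⦃ ℕ.>-nonZero 0<n ⦄ (∣⇒∣ᵤ p∣n))

  unit-by-≡ : ∀ {x y} → x ≡ y → ¬ + p ∣ y → ¬ + p ∣ x
  unit-by-≡ refl y≢0 = y≢0

  unit-by-≋ : ∀ {x y} → x ≋ y → ¬ + p ∣ y → ¬ + p ∣ x
  unit-by-≋ {x} {y} (congruent p∣x-y) y≢0 p∣x = y≢0 (∣-by (eq x y) (∣m∣n⇒∣m-n p∣x p∣x-y))
    where eq : ∀ x y → x - (x - y) ≡ y
          eq = solve-∀

  1≢0 : ¬ + p ∣ + 1
  1≢0 = small-unit (s≤s z≤n) 1<p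

  ≋1⇒unit : ∀ {x} → x ≋ + 1 → ¬ + p ∣ x
  ≋1⇒unit x≋1 = unit-by-≋ x≋1 1≢0

  p≡2+ : ∃ λ q → p ≡ suc (suc q)
  p≡2+ = 2+ p 1<p
    where
    2+ : ∀ n → 1 ℕ.< n → ∃ λ q → n ≡ suc (suc q)
    2+ (suc (suc q)) _ = q , refl
    2+ (suc zero) (s≤s ())

module Fermat (p : ℕ) (p-prime : Prime p) where

  open Congruence p p-prime
  open import Data.Integer.Base using (_^_)
  open import Data.Integer.DivMod using (_%ℕ_; _/ℕ_; a≡a%ℕn+[a/ℕn]*n)
  open import Data.Fin.Base using (Fin; zero; suc; toℕ; fromℕ; inject₁)
  import Data.Fin.Properties as Fin
  open import Data.Nat.Combinatorics using (_C_; nCn≡1; k![n∸k]!∣n!; nCk≡n!/k![n-k]!)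
  open import Data.Nat.DivMod using (m*[n/m]≡n)
  open import Algebra.Properties.CommutativeSemiring.Binomial ℤ.+-*-commutativeSemiring
    using (binomial; binomialTerm) renaming (theorem to binomial-theorem)
  open import Algebra.Properties.Semiring.Sum ℤ.+-*-semiring using (sum; sum-init-last)
  open import Algebra.Properties.Semiring.Mult ℤ.+-*-semiring using () renaming (_×_ to _×ₙ_)
  open import Algebra.Properties.Semiring.Exp ℤ.+-*-semiring using () renaming (_^_ to _^′_)
  open import Data.Vec.Functional using (init; last)
  open SetoidReasoning ≋-setoid

  private instance
    p≢0 : ℕ.NonZero p
    p≢0 = prime⇒nonZero p-prime

  p∤! : ∀ {j} → j ℕ.< p → ¬ p ℕ.∣ j !
  p∤! {zero} _ p∣1 = ℕ.<-irrefl (sym (ℕ.∣1⇒≡1 p∣1)) 1<p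
  p∤! {suc j} j<p p∣j! with euclidsLemma (suc j) (j !) p-prime p∣j!
  ... | inj₁ p∣1+j = ℕ.<⇒≱ j<p (ℕ.∣⇒≤ p∣1+j)
  ... | inj₂ p∣j! = p∤! (ℕ.<-trans (ℕ.n<1+n j) j<p) p∣j!

  n∣n! : ∀ {n} → 0 ℕ.< n → n ℕ.∣ n !
  n∣n! {suc n} _ = ℕ.∣m⇒∣m*n (n !) ℕ.∣-refl

  p∣k![p∸k]!pCk : ∀ {k} → k ℕ.≤ p → p ℕ.∣ k ! ℕ.* (p ∸ k) ! ℕ.* (p C k)
  p∣k![p∸k]!pCk {k} k≤p = subst (p ℕ.∣_) (sym k![p∸k]!pCk≡p!) (n∣n! (ℕ.>-nonZero⁻¹ p))
    where
    instance _ = k ℕ.!* (p ∸ k) !≢0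
    k![p∸k]!pCk≡p! : k ! ℕ.* (p ∸ k) ! ℕ.* (p C k) ≡ p !
    k![p∸k]!pCk≡p! = trans (cong (k ! ℕ.* (p ∸ k) ! ℕ.*_) (nCk≡n!/k![n-k]! k≤p)) (m*[n/m]≡n (k![n∸k]!∣n! k≤p))

  p∣pCk : ∀ {k} → 0 ℕ.< k → k ℕ.< p → p ℕ.∣ p C k
  p∣pCk {k} 0<k k<p with euclidsLemma (k ! ℕ.* (p ∸ k) !) (p C k) p-prime (p∣k![p∸k]!pCk (ℕ.<⇒≤ k<p))
  ... | inj₂ p∣pCk = p∣pCk
  ... | inj₁ p∣k![p∸k]! with euclidsLemma (k !) ((p ∸ k) !) p-prime p∣k![p∸k]!
  ...   | inj₁ p∣k! = ⊥-elim (p∤! k<p p∣k!)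
  ...   | inj₂ p∣[p∸k]! = ⊥-elim (p∤! (ℕ.∸-monoʳ-< 0<k (ℕ.<⇒≤ k<p)) p∣[p∸k]!)

  ×ₙ≡* : ∀ n x → n ×ₙ x ≡ + n * x
  ×ₙ≡* zero x = refl
  ×ₙ≡* (suc n) x = trans (cong (λ m → x + m) (×ₙ≡* n x)) (eq x (+ n))
    where eq : ∀ x m → x + m * x ≡ (+ 1 + m) * x
          eq = solve-∀

  ^′≡^ : ∀ x n → x ^′ n ≡ x ^ n
  ^′≡^ x zero = refl
  ^′≡^ x (suc n) = cong (x *_) (^′≡^ x n)

  ∣-×ₙ : ∀ {n} x → p ℕ.∣ n → + p ∣ n ×ₙ x
  ∣-×ₙ {n} x p∣n = ∣-by (sym (×ₙ≡* n x)) (∣m⇒∣m*n x (∣ᵤ⇒∣ {+ p} {+ n} p∣n))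

  ∣-sum : ∀ {n} (f : Fin n → ℤ) → (∀ i → + p ∣ f i) → + p ∣ sum f
  ∣-sum {zero} f _ = p∣0
  ∣-sum {suc n} f p∣f = ∣m∣n⇒∣m+n (p∣f zero) (∣-sum (f ∘ suc) (p∣f ∘ suc))

  binomialTerm-first : ∀ x y n → binomialTerm x y n zero ≡ y ^ n
  binomialTerm-first x y n = trans (ℤ.+-identityʳ _) (trans (ℤ.*-identityˡ _) (^′≡^ y n))

  binomialTerm-last : ∀ x y n → binomialTerm x y n (fromℕ n) ≡ x ^ n
  binomialTerm-last x y n rewrite Fin.toℕ-fromℕ n | nCn≡1 n | ℕ.n∸n≡0 n =
    trans (ℤ.+-identityʳ _) (trans (ℤ.*-identityʳ _) (^′≡^ x n))

  frobenius : ∀ x y → (x + y) ^ p ≋ x ^ p + y ^ p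
  frobenius x y with p≡2+
  ... | q , refl = begin
    (x + y) ^ p                                         ≡⟨ ^′≡^ (x + y) p ⟨
    (x + y) ^′ p                                        ≡⟨ binomial-theorem p x y ⟩
    t zero + sum (t ∘ suc)                              ≡⟨ cong (λ s → t zero + s) (sum-init-last (t ∘ suc)) ⟩
    t zero + (sum (init (t ∘ suc)) + last (t ∘ suc))    ≈⟨ +-cong first-term (+-cong (∣⇒≋0 (∣-sum _ p∣middle)) last-term) ⟩
    y ^ p + (+ 0 + x ^ p)                               ≡⟨ eq (x ^ p) (y ^ p) ⟩
    x ^ p + y ^ p                                       ∎
    where
    t = binomialTerm x y p
    first-term = ≡⇒≋ (binomialTerm-first x y p)
    last-term = ≡⇒≋ (binomialTerm-last x y p)
    p∣middle : ∀ i → + p ∣ t (suc (inject₁ i))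
    p∣middle i = ∣-×ₙ (binomial x y p (suc (inject₁ i))) (p∣pCk (s≤s z≤n) (s≤s k<1+q))
      where k<1+q : ℕ.suc (toℕ (inject₁ i)) ℕ.≤ suc q
            k<1+q = subst (ℕ._< suc q) (sym (Fin.toℕ-inject₁ i)) (Fin.toℕ<n i)
    eq : ∀ u v → v + (+ 0 + u) ≡ u + v
    eq = solve-∀

  ^-cong : ∀ {x y} n → x ≋ y → x ^ n ≋ y ^ n
  ^-cong zero _ = ≋-refl
  ^-cong (suc n) x≋y = *-cong x≋y (^-cong n x≋y)

  fermat-ℕ : ∀ n → (+ n) ^ p ≋ + n
  fermat-ℕ zero with p≡2+
  ... | q , refl = ≋-refl
  fermat-ℕ (suc n) = begin
    (+ 1 + + n) ^ p        ≈⟨ frobenius (+ 1) (+ n) ⟩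
    (+ 1) ^ p + (+ n) ^ p  ≈⟨ +-cong (≡⇒≋ (ℤ.^-zeroˡ p)) (fermat-ℕ n) ⟩
    + 1 + + n              ∎

  ≋-residue : ∀ x → x ≋ + (x %ℕ p)
  ≋-residue x =
    ≋-by (q * + p) (sym (trans (cong (_- r) (a≡a%ℕn+[a/ℕn]*n x p)) (eq r (q * + p)))) (∣n⇒∣m*n q ∣-refl)
    where
    r = + (x %ℕ p)
    q = x /ℕ p
    eq : ∀ r m → r + m - r ≡ m
    eq = solve-∀

  fermat : ∀ x → x ^ p ≋ x
  fermat x = begin
    x ^ p      ≈⟨ ^-cong p (≋-residue x) ⟩
    (+ r) ^ p  ≈⟨ fermat-ℕ r ⟩
    + r        ≈⟨ ≋-residue x ⟨
    x          ∎
    where r = x %ℕ p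

  fermat-unit : ∀ {x} → ¬ + p ∣ x → x ^ (p ∸ 1) ≋ + 1
  fermat-unit {x} x≢0 with p≡2+
  ... | q , refl = cancelˡ-≋ x≢0 (≋-trans (fermat x) (≡⇒≋ (sym (ℤ.*-identityʳ x))))

  inverse : ∀ {x} → ¬ + p ∣ x → ∃ λ y → x * y ≋ + 1
  inverse {x} x≢0 with p≡2+
  ... | q , refl = x ^ q , fermat-unit x≢0

module FiniteDifferences (p : ℕ) (p-prime : Prime p) where

  open Congruence p p-prime
  open Fermat p p-prime using (p∤!)
  open import Data.Integer.Base using (_^_)
  open import Data.Fin.Base using (Fin; zero; suc; toℕ; inject₁)
  open import Data.Fin.Properties using (¬∀⟶∃¬)
  import Data.Fin.Properties as Fin

  Δ : (ℤ → ℤ) → ℤ → ℤ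
  Δ f x = f (x + + 1) - f x

  Δ^ : ℕ → (ℤ → ℤ) → ℤ → ℤ
  Δ^ zero f = f
  Δ^ (suc n) f = Δ^ n (Δ f)

  -- f is a polynomial function of degree at most d whose coefficient of x^d is c:
  -- Δ lowers the degree by one and multiplies the leading coefficient by the degree.
  Leading : ℕ → ℤ → (ℤ → ℤ) → Set
  Leading zero c f = ∀ x → f x ≡ c
  Leading (suc d) c f = Leading d (c * + suc d) (Δ f)

  leading-ext : ∀ d {c f g} → (∀ x → f x ≡ g x) → Leading d c f → Leading d c g
  leading-ext zero f≗g lead x = trans (sym (f≗g x)) (lead x)
  leading-ext (suc d) f≗g lead = leading-ext d (λ x → cong₂ _-_ (f≗g (x + + 1)) (f≗g x)) lead

  leading-+ : ∀ d {c c′ f g} → Leading d c f → Leading d c′ g → Leading d (c + c′) (λ x → f x + g x)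
  leading-+ zero lead lead′ x = cong₂ _+_ (lead x) (lead′ x)
  leading-+ (suc d) {c} {c′} {f} {g} lead lead′ =
    subst (λ e → Leading d e (Δ (λ x → f x + g x))) (sym (ℤ.*-distribʳ-+ (+ suc d) c c′))
      (leading-ext d (λ x → eq (f (x + + 1)) (f x) (g (x + + 1)) (g x)) (leading-+ d lead lead′))
    where eq : ∀ a b c d → (a - b) + (c - d) ≡ (a + c) - (b + d)
          eq = solve-∀

  leading-shift : ∀ d {c f} → Leading d c f → Leading d c (λ x → f (x + + 1))
  leading-shift zero lead x = lead (x + + 1)
  leading-shift (suc d) lead = leading-shift d lead

  leading-raise : ∀ d {c f} → Leading d c f → Leading (suc d) (+ 0) f
  leading-raise zero {c} lead x = trans (cong₂ _-_ (lead (x + + 1)) (lead x)) (ℤ.+-inverseʳ c)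
  leading-raise (suc d) lead = leading-raise d lead

  leading-const : ∀ d c → Leading (suc d) (+ 0) (λ _ → c)
  leading-const zero c = leading-raise zero {c} {λ _ → c} (λ _ → refl)
  leading-const (suc d) c = leading-raise (suc d) {+ 0} {λ _ → c} (leading-const d c)

  leading-x* : ∀ d {c f} → Leading d c f → Leading (suc d) c (λ x → x * f x)
  leading-x* zero {c} {f} lead x = begin
    (x + + 1) * f (x + + 1) - x * f x    ≡⟨ eq x (f (x + + 1)) (f x) ⟩
    x * (f (x + + 1) - f x) + f (x + + 1) ≡⟨ cong₂ (λ u v → x * (u - v) + u) (lead (x + + 1)) (lead x) ⟩
    x * (c - c) + c                       ≡⟨ eq′ x c ⟩
    c * + 1                               ∎
    where open ≡-Reasoning
          eq : ∀ x a b → (x + + 1) * a - x * b ≡ x * (a - b) + a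
          eq = solve-∀
          eq′ : ∀ x c → x * (c - c) + c ≡ c * + 1
          eq′ = solve-∀
  leading-x* (suc d) {c} {f} lead =
    subst (λ e → Leading (suc d) e (Δ (λ x → x * f x))) (eq′ c (+ suc d))
      (leading-ext (suc d) {c * + suc d + c} (λ x → sym (eq x (f (x + + 1)) (f x)))
        (leading-+ (suc d) {c * + suc d} {c} {λ x → x * Δ f x} {λ x → f (x + + 1)}
          (leading-x* d {c * + suc d} {Δ f} lead) (leading-shift (suc d) {c} {f} lead)))
    where eq : ∀ x a b → (x + + 1) * a - x * b ≡ x * (a - b) + a
          eq = solve-∀
          eq′ : ∀ c n → c * n + c ≡ c * (+ 1 + n)
          eq′ = solve-∀

  leading-pow : ∀ m → Leading m (+ 1) (_^ m)
  leading-pow zero x = refl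
  leading-pow (suc m) = leading-x* m (leading-pow m)

  Δ^-leading : ∀ d {c f} → Leading d c f → ∀ x → Δ^ d f x ≡ c * + (d !)
  Δ^-leading zero lead x = trans (lead x) (sym (ℤ.*-identityʳ _))
  Δ^-leading (suc d) {c} lead x =
    trans (Δ^-leading d lead x)
          (trans (ℤ.*-assoc c (+ suc d) (+ (d !))) (cong (c *_) (sym (ℤ.pos-* (suc d) (d !)))))

  Δ^-vanishing : ∀ n f x → (∀ (j : Fin (suc n)) → + p ∣ f (x + + toℕ j)) → + p ∣ Δ^ n f x
  Δ^-vanishing zero f x vanish = ∣-by (cong f (ℤ.+-identityʳ x)) (vanish zero)
  Δ^-vanishing (suc n) f x vanish = Δ^-vanishing n (Δ f) x Δf-vanish
    where
    Δf-vanish : ∀ (j : Fin (suc n)) → + p ∣ Δ f (x + + toℕ j)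
    Δf-vanish j = ∣m∣n⇒∣m-n (∣-by (cong f (eq x (+ toℕ j))) (vanish (suc j)))
                            (∣-by (cong (λ k → f (x + + k)) (Fin.toℕ-inject₁ j)) (vanish (inject₁ j)))
      where eq : ∀ x k → x + (+ 1 + k) ≡ x + k + + 1
            eq = solve-∀

  powers-not-all-one : ∀ {m} → 0 ℕ.< m → m ℕ.< p → ¬ (∀ (j : Fin (suc m)) → (+ suc (toℕ j)) ^ m ≋ + 1)
  powers-not-all-one {suc m} _ m<p all-one =
    p∤! m<p (∣⇒∣ᵤ (∣-by Δ^g≡[1+m]! (Δ^-vanishing (suc m) g (+ 1) (divides-difference ∘ all-one))))
    where
    g : ℤ → ℤ
    g y = y ^ suc m - + 1
    g-leading : Leading (suc m) (+ 1) g
    g-leading = leading-+ (suc m) {+ 1} {+ 0} {_^ suc m} (leading-pow (suc m)) (leading-const m (- + 1))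
    Δ^g≡[1+m]! : Δ^ (suc m) g (+ 1) ≡ + (suc m !)
    Δ^g≡[1+m]! = trans (Δ^-leading (suc m) {+ 1} {g} g-leading (+ 1)) (ℤ.*-identityˡ _)

  non-root : ∀ {m} → 0 ℕ.< m → suc m ℕ.< p → ∃ λ n → ¬ + p ∣ + n × ¬ (+ n) ^ m ≋ + 1
  non-root {m} 0<m 1+m<p
    with ¬∀⟶∃¬ (suc m) _ (λ j → ≋-dec _ _) (powers-not-all-one 0<m (ℕ.<-trans (ℕ.n<1+n m) 1+m<p))
  ... | j , j-non-root = suc (toℕ j) , small-unit (s≤s z≤n) (ℕ.≤-<-trans (Fin.toℕ<n j) 1+m<p) , j-non-root

module Roots (p : ℕ) (p-prime : Prime p) where

  open Congruence p p-prime
  open Fermat p p-prime using (fermat-unit; inverse)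
  open FiniteDifferences p p-prime using (non-root)
  open import Data.Integer.Base using (_^_)
  open SetoidReasoning ≋-setoid

  quotient-positive : ∀ k m → p ≡ suc (k ℕ.* m) → 0 ℕ.< m
  quotient-positive k zero p≡1 =
    ⊥-elim (ℕ.<-irrefl (sym (trans p≡1 (cong suc (ℕ.*-zeroʳ k)))) 1<p)
  quotient-positive k (suc m) _ = s≤s z≤n

  13≤p : ∀ m → p ≡ suc (12 ℕ.* m) → 13 ℕ.≤ p
  13≤p m p≡ = subst (13 ℕ.≤_) (sym p≡) (s≤s (ℕ.*-monoʳ-≤ 12 (quotient-positive 12 m p≡)))

  power-is-root-of-unity : ∀ k m → p ≡ suc (k ℕ.* m) → ∀ {a} → ¬ + p ∣ a → (a ^ m) ^ k ≋ + 1
  power-is-root-of-unity k m p≡ {a} a≢0 = begin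
    (a ^ m) ^ k     ≡⟨ ℤ.^-*-assoc a m k ⟩
    a ^ (m ℕ.* k)   ≡⟨ cong (a ^_) (trans (ℕ.*-comm m k) (cong (_∸ 1) (sym p≡))) ⟩
    a ^ (p ∸ 1)     ≈⟨ fermat-unit a≢0 ⟩
    + 1             ∎

  square-root-of-one : ∀ {y} → y * y ≋ + 1 → ¬ y ≋ + 1 → y ≋ - + 1
  square-root-of-one {y} y²≋1 y≢1 =
    congruent (cancelˡ (y≢1 ∘ congruent) (∣-by (eq y) (divides-difference y²≋1)))
    where eq : ∀ y → y * y - + 1 ≡ (y - + 1) * (y + + 1)
          eq = solve-∀

  cube-root-of-one : ∀ {w} → w * (w * w) ≋ + 1 → ¬ w ≋ + 1 → w * w + w + + 1 ≋ + 0
  cube-root-of-one {w} w³≋1 w≢1 =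
    ∣⇒≋0 (cancelˡ (w≢1 ∘ congruent) (∣-by (eq w) (divides-difference w³≋1)))
    where eq : ∀ w → w * (w * w) - + 1 ≡ (w - + 1) * (w * w + w + + 1)
          eq = solve-∀

  sqrt-minus-one : ∀ m → p ≡ suc (4 ℕ.* m) → ∃ λ i → i * i ≋ - + 1
  sqrt-minus-one m p≡ = i , square-root-of-one i²i²≋1 i²≢1
    where
    0<m = quotient-positive 4 m p≡
    witness = non-root {m ℕ.+ m} (ℕ.<-≤-trans 0<m (ℕ.m≤m+n m m))
      (subst (suc (m ℕ.+ m) ℕ.<_) (sym p≡) (s≤s (ℕ.+-monoʳ-< m (ℕ.m<m+n m (ℕ.<-≤-trans 0<m (ℕ.m≤m+n m _))))))
    a : ℤ
    a = + proj₁ witness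
    i : ℤ
    i = a ^ m
    i²≢1 : ¬ i * i ≋ + 1
    i²≢1 = proj₂ (proj₂ witness) ∘ ≋-trans (≡⇒≋ (ℤ.^-distribˡ-+-* a m m))
    i²i²≋1 : (i * i) * (i * i) ≋ + 1
    i²i²≋1 = ≋-trans (≡⇒≋ (eq i)) (power-is-root-of-unity 4 m p≡ (proj₁ (proj₂ witness)))
      where eq : ∀ i → (i * i) * (i * i) ≡ i * (i * (i * (i * + 1)))
            eq = solve-∀

  cube-root-of-unity : ∀ m → p ≡ suc (3 ℕ.* m) → ∃ λ w → w * w + w + + 1 ≋ + 0
  cube-root-of-unity m p≡ = w , cube-root-of-one w³≋1 (proj₂ (proj₂ witness))
    where
    0<m = quotient-positive 3 m p≡
    witness = non-root {m} 0<m (subst (suc m ℕ.<_) (sym p≡) (s≤s (ℕ.m<m+n m (ℕ.<-≤-trans 0<m (ℕ.m≤m+n m _)))))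
    w : ℤ
    w = (+ proj₁ witness) ^ m
    w³≋1 : w * (w * w) ≋ + 1
    w³≋1 = ≋-trans (≡⇒≋ (eq w)) (power-is-root-of-unity 3 m p≡ (proj₁ (proj₂ witness)))
      where eq : ∀ w → w * (w * w) ≡ w * (w * (w * + 1))
            eq = solve-∀

  -- (2w + 1)² = 4 (w² + w + 1) − 3 = −3, so x = i (2w + 1) / 3 has 3x² = 1.
  sqrt-one-third-from : ∀ {i w t} → i * i ≋ - + 1 → w * w + w + + 1 ≋ + 0 → + 3 * t ≋ + 1 →
    let x = i * (+ 2 * w + + 1) * t in + 3 * (x * x) ≋ + 1
  sqrt-one-third-from {i} {w} {t} (congruent p∣i²+1) w²+w+1≋0 (congruent p∣3t-1) =
    ≋-by _ (certificate i w t)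
      (∣m∣n⇒∣m+n (∣n⇒∣m*n (+ 3 * s * s * t * t) p∣i²+1)
        (∣m∣n⇒∣m+n (∣n⇒∣m*n (- (+ 12 * t * t)) (≋0⇒∣ w²+w+1≋0)) (∣n⇒∣m*n (+ 3 * t + + 1) p∣3t-1)))
    where
    s = + 2 * w + + 1
    certificate : ∀ i w t →
        (+ 3 * (+ 2 * w + + 1) * (+ 2 * w + + 1) * t * t) * (i * i + + 1)
      + (- (+ 12 * t * t) * (w * w + w + + 1) + (+ 3 * t + + 1) * (+ 3 * t - + 1))
      ≡ + 3 * ((i * (+ 2 * w + + 1) * t) * (i * (+ 2 * w + + 1) * t)) - + 1
    certificate = solve-∀

  sqrt-one-third : ∀ m → p ≡ suc (12 ℕ.* m) → ∃ λ x → + 3 * (x * x) ≋ + 1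
  sqrt-one-third m p≡ =
    proj₁ i * (+ 2 * proj₁ w + + 1) * proj₁ t ,
    sqrt-one-third-from {proj₁ i} {proj₁ w} {proj₁ t} (proj₂ i) (proj₂ w) (proj₂ t)
    where
    i = sqrt-minus-one (3 ℕ.* m) (trans p≡ (cong suc (ℕ.*-assoc 4 3 m)))
    w = cube-root-of-unity (4 ℕ.* m) (trans p≡ (cong suc (ℕ.*-assoc 3 4 m)))
    t = inverse (small-unit {3} (s≤s z≤n) (ℕ.≤-trans (ℕ.m≤m+n 4 9) (13≤p m p≡)))

module Matrices (p : ℕ) (p-prime : Prime p) where

  open Congruence p p-prime
  open import Defs

  infix 4 _≋ₘ_
  record _≋ₘ_ (g h : Mat) : Set where
    constructor entrywise
    field
      ≋a : a g ≋ a h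
      ≋b : b g ≋ b h
      ≋c : c g ≋ c h
      ≋d : d g ≋ d h
  open _≋ₘ_ public

  entrywise-≡ : ∀ {g h} → a g ≡ a h → b g ≡ b h → c g ≡ c h → d g ≡ d h → g ≋ₘ h
  entrywise-≡ ea eb ec ed = entrywise (≡⇒≋ ea) (≡⇒≋ eb) (≡⇒≋ ec) (≡⇒≋ ed)

  ≋ₘ-refl : ∀ {g} → g ≋ₘ g
  ≋ₘ-refl = entrywise ≋-refl ≋-refl ≋-refl ≋-refl

  ≋ₘ-sym : ∀ {g h} → g ≋ₘ h → h ≋ₘ g
  ≋ₘ-sym (entrywise ea eb ec ed) = entrywise (≋-sym ea) (≋-sym eb) (≋-sym ec) (≋-sym ed)

  ≋ₘ-trans : ∀ {g h k} → g ≋ₘ h → h ≋ₘ k → g ≋ₘ k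
  ≋ₘ-trans (entrywise ea eb ec ed) (entrywise ea′ eb′ ec′ ed′) =
    entrywise (≋-trans ea ea′) (≋-trans eb eb′) (≋-trans ec ec′) (≋-trans ed ed′)

  ≋ₘ-setoid : Setoid _ _
  ≋ₘ-setoid = record
    { Carrier = Mat
    ; _≈_ = _≋ₘ_
    ; isEquivalence = record { refl = ≋ₘ-refl ; sym = ≋ₘ-sym ; trans = ≋ₘ-trans }
    }

  ·-cong : ∀ {g g′ h h′} → g ≋ₘ g′ → h ≋ₘ h′ → g · h ≋ₘ g′ · h′
  ·-cong (entrywise ea eb ec ed) (entrywise ea′ eb′ ec′ ed′) =
    entrywise (+-cong (*-cong ea ea′) (*-cong eb ec′)) (+-cong (*-cong ea eb′) (*-cong eb ed′))
              (+-cong (*-cong ec ea′) (*-cong ed ec′)) (+-cong (*-cong ec eb′) (*-cong ed ed′))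

  ⁻¹-cong : ∀ {g h} → g ≋ₘ h → g ⁻¹ ≋ₘ h ⁻¹
  ⁻¹-cong (entrywise ea eb ec ed) = entrywise ed (-‿cong eb) (-‿cong ec) ea

  ^-cong : ∀ {g h} n → g ≋ₘ h → g ^ n ≋ₘ h ^ n
  ^-cong zero _ = ≋ₘ-refl
  ^-cong (suc n) g≋h = ·-cong g≋h (^-cong n g≋h)

  det-cong : ∀ {g h} → g ≋ₘ h → det g ≋ det h
  det-cong (entrywise ea eb ec ed) = +-cong (*-cong ea ed) (-‿cong (*-cong eb ec))

  ·-identityʳ : ∀ g → g · I ≋ₘ g
  ·-identityʳ (mat a b c d) = entrywise-≡ (eq a b) (eq′ a b) (eq c d) (eq′ c d)
    where eq : ∀ x y → x * + 1 + y * + 0 ≡ x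
          eq = solve-∀
          eq′ : ∀ x y → x * + 0 + y * + 1 ≡ y
          eq′ = solve-∀

  det-· : ∀ g h → det (g · h) ≡ det g * det h
  det-· (mat a₁ b₁ c₁ d₁) (mat a₂ b₂ c₂ d₂) = eq a₁ b₁ c₁ d₁ a₂ b₂ c₂ d₂
    where eq : ∀ a₁ b₁ c₁ d₁ a₂ b₂ c₂ d₂ →
                 (a₁ * a₂ + b₁ * c₂) * (c₁ * b₂ + d₁ * d₂) - (a₁ * b₂ + b₁ * d₂) * (c₁ * a₂ + d₁ * c₂)
               ≡ (a₁ * d₁ - b₁ * c₁) * (a₂ * d₂ - b₂ * c₂)
          eq = solve-∀

  negate : Mat → Mat
  negate g = mat (- a g) (- b g) (- c g) (- d g)

  scale : ℤ → Mat → Mat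
  scale s g = mat (s * a g) (s * b g) (s * c g) (s * d g)

  upper lower : ℤ → Mat
  upper y = mat (+ 1) y (+ 0) (+ 1)
  lower y = mat (+ 1) (+ 0) y (+ 1)

  negate-cong : ∀ {g h} → g ≋ₘ h → negate g ≋ₘ negate h
  negate-cong (entrywise ea eb ec ed) = entrywise (-‿cong ea) (-‿cong eb) (-‿cong ec) (-‿cong ed)

  scale-· : ∀ s t g h → scale s g · scale t h ≋ₘ scale (s * t) (g · h)
  scale-· s t (mat a₁ b₁ c₁ d₁) (mat a₂ b₂ c₂ d₂) =
    entrywise-≡ (eq s t a₁ a₂ b₁ c₂) (eq s t a₁ b₂ b₁ d₂) (eq s t c₁ a₂ d₁ c₂) (eq s t c₁ b₂ d₁ d₂)
    where eq : ∀ s t x y z w → s * x * (t * y) + s * z * (t * w) ≡ s * t * (x * y + z * w)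
          eq = solve-∀

  scale-scale : ∀ s t g → scale s (scale t g) ≋ₘ scale (s * t) g
  scale-scale s t g = entrywise-≡ (assoc (a g)) (assoc (b g)) (assoc (c g)) (assoc (d g))
    where assoc : ∀ x → s * (t * x) ≡ s * t * x
          assoc x = sym (ℤ.*-assoc s t x)

  scale-comm : ∀ s t g → scale (s * t) g ≋ₘ scale (t * s) g
  scale-comm s t g = entrywise-≡ (comm (a g)) (comm (b g)) (comm (c g)) (comm (d g))
    where comm : ∀ x → s * t * x ≡ t * s * x
          comm x = cong (_* x) (ℤ.*-comm s t)

  scale-negate : ∀ s g → scale s (negate g) ≋ₘ negate (scale s g)
  scale-negate s g = entrywise-≡ (neg (a g)) (neg (b g)) (neg (c g)) (neg (d g))
    where neg : ∀ x → s * - x ≡ - (s * x)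
          neg x = sym (ℤ.neg-distribʳ-* s x)


  scale-≋-1 : ∀ {s} g → s ≋ - + 1 → scale s g ≋ₘ negate g
  scale-≋-1 {s} g s≋-1 = entrywise (unit (a g)) (unit (b g)) (unit (c g)) (unit (d g))
    where unit : ∀ x → s * x ≋ - x
          unit x = ≋-trans (*-cong {s} { - + 1} {x} {x} s≋-1 ≋-refl) (≡⇒≋ (ℤ.-1*i≡-i x))

  det-scale : ∀ s g → det (scale s g) ≡ s * s * det g
  det-scale s (mat a b c d) = eq s a b c d
    where eq : ∀ s a b c d → s * a * (s * d) - s * b * (s * c) ≡ s * s * (a * d - b * c)
          eq = solve-∀

  scaled-product : ∀ s t R R′ → s * t ≋ - + 1 → scale s R · scale t R′ ≋ₘ negate (R · R′)
  scaled-product s t R R′ st≋-1 = ≋ₘ-trans (scale-· s t R R′) (scale-≋-1 (R · R′) st≋-1)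

  upper-+ : ∀ x y → upper x · upper y ≋ₘ upper (x + y)
  upper-+ x y = entrywise-≡ (eq₁ x) (eq₂ x y) refl refl
    where eq₁ : ∀ x → + 1 * + 1 + x * + 0 ≡ + 1
          eq₁ = solve-∀
          eq₂ : ∀ x y → + 1 * y + x * + 1 ≡ x + y
          eq₂ = solve-∀

  upper-power : ∀ n → upper (+ 1) ^ n ≋ₘ upper (+ n)
  upper-power zero = ≋ₘ-refl
  upper-power (suc n) = ≋ₘ-trans (·-cong (≋ₘ-refl {upper (+ 1)}) (upper-power n)) (upper-+ (+ 1) (+ n))

  det-upper : ∀ y → det (upper y) ≡ + 1
  det-upper y = eq y
    where eq : ∀ y → + 1 * + 1 - y * + 0 ≡ + 1
          eq = solve-∀

  det-lower : ∀ y → det (lower y) ≡ + 1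
  det-lower y = eq y
    where eq : ∀ y → + 1 * + 1 - + 0 * y ≡ + 1
          eq = solve-∀

  det-upper-sandwich : ∀ x y g → det ((upper x · g) · upper y) ≡ det g
  det-upper-sandwich x y g = begin
    det ((upper x · g) · upper y)           ≡⟨ det-· (upper x · g) (upper y) ⟩
    det (upper x · g) * det (upper y)       ≡⟨ cong₂ _*_ (det-· (upper x) g) (det-upper y) ⟩
    det (upper x) * det g * + 1             ≡⟨ cong (λ e → e * det g * + 1) (det-upper x) ⟩
    + 1 * det g * + 1                       ≡⟨ eq (det g) ⟩
    det g                                   ∎
    where open ≡-Reasoning
          eq : ∀ e → + 1 * e * + 1 ≡ e
          eq = solve-∀

  det-lower-· : ∀ x g → det (lower x · g) ≡ det g
  det-lower-· x g = trans (det-· (lower x) g) (trans (cong (_* det g) (det-lower x)) (ℤ.*-identityˡ (det g)))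

  lower-shear : ∀ g → lower (- + 1) · (lower (+ 1) · g) ≋ₘ g
  lower-shear (mat a b c d) = entrywise-≡ (eq₁ a c) (eq₁ b d) (eq₂ a c) (eq₂ b d)
    where eq₁ : ∀ x y → + 1 * (+ 1 * x + + 0 * y) + + 0 * (+ 1 * x + + 1 * y) ≡ x
          eq₁ = solve-∀
          eq₂ : ∀ x y → - + 1 * (+ 1 * x + + 0 * y) + + 1 * (+ 1 * x + + 1 * y) ≡ y
          eq₂ = solve-∀

  unipotent-decomposition : ∀ {a b c d ci} → c * ci ≋ + 1 → det (mat a b c d) ≋ + 1 →
    (upper ((a - + 1) * ci) · lower c) · upper ((d - + 1) * ci) ≋ₘ mat a b c d
  unipotent-decomposition {a} {b} {c} {d} {ci} (congruent u) (congruent v) = entrywise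
    (≋-by-multiple (a - + 1) (eqa a c ci) u)
    (≋-by-combination (b + (a - + 1) * (d - + 1) * ci) ci (eqb a b c d ci) u v)
    (≡⇒≋ (eqc c))
    (≋-by-multiple (d - + 1) (eqd c d ci) u)
    where
    eqa : ∀ a c ci → (+ 1 * + 1 + (a - + 1) * ci * c) * + 1 + (+ 1 * + 0 + (a - + 1) * ci * + 1) * + 0 - a
        ≡ (a - + 1) * (c * ci - + 1)
    eqa = solve-∀
    eqb : ∀ a b c d ci →
          (+ 1 * + 1 + (a - + 1) * ci * c) * ((d - + 1) * ci) + (+ 1 * + 0 + (a - + 1) * ci * + 1) * + 1 - b
        ≡ (b + (a - + 1) * (d - + 1) * ci) * (c * ci - + 1) + ci * (a * d - b * c - + 1)
    eqb = solve-∀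
    eqc : ∀ c → (+ 0 * + 1 + + 1 * c) * + 1 + (+ 0 * + 0 + + 1 * + 1) * + 0 ≡ c
    eqc = solve-∀
    eqd : ∀ c d ci → (+ 0 * + 1 + + 1 * c) * ((d - + 1) * ci) + (+ 0 * + 0 + + 1 * + 1) * + 1 - d
        ≡ (d - + 1) * (c * ci - + 1)
    eqd = solve-∀

  antidiagonalise : ∀ {a₀ b₀ c₀ d₀ ci} → c₀ * ci ≋ + 1 →
    let M = (upper (- (a₀ * ci)) · mat a₀ b₀ c₀ d₀) · upper (- (d₀ * ci)) in a M ≋ + 0 × c M ≋ c₀ × d M ≋ + 0
  antidiagonalise {a₀} {b₀} {c₀} {d₀} {ci} (congruent u) =
    ≋-by-multiple (- a₀) (eqa a₀ b₀ c₀ d₀ ci) u ,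
    ≡⇒≋ (eqc a₀ b₀ c₀ d₀) ,
    ≋-by-multiple (- d₀) (eqd a₀ b₀ c₀ d₀ ci) u
    where
    eqa : ∀ a b c d ci →
          (+ 1 * a + - (a * ci) * c) * + 1 + (+ 1 * b + - (a * ci) * d) * + 0 - + 0 ≡ - a * (c * ci - + 1)
    eqa = solve-∀
    eqc : ∀ a b c d → (+ 0 * a + + 1 * c) * + 1 + (+ 0 * b + + 1 * d) * + 0 ≡ c
    eqc = solve-∀
    eqd : ∀ a b c d ci → (+ 0 * a + + 1 * c) * - (d * ci) + (+ 0 * b + + 1 * d) * + 1 - + 0 ≡ - d * (c * ci - + 1)
    eqd = solve-∀

  antidiagonal-conjugate : ∀ {N C} z → a N ≋ + 0 × c N ≋ C × d N ≋ + 0 → det N ≋ + 1 →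
    (N · upper z) · (N ⁻¹) ≋ₘ lower (- (C * C * z))
  antidiagonal-conjugate {N} {C} z (a≋0 , c≋C , d≋0) det≋1 =
    ≋ₘ-trans (·-cong (·-cong N≋N′ ≋ₘ-refl) (⁻¹-cong N≋N′))
      (entrywise (≋-by-multiple (+ 1) (eqa B C z) v) (≡⇒≋ (eqb B z))
                 (≡⇒≋ (eqc C z)) (≋-by-multiple (+ 1) (eqd B C z) v))
    where
    B = b N
    N′ = mat (+ 0) B C (+ 0)
    N≋N′ : N ≋ₘ N′
    N≋N′ = entrywise a≋0 ≋-refl c≋C d≋0
    v : + p ∣ det N′ - + 1
    v = divides-difference (≋-trans (≋-sym (det-cong N≋N′)) det≋1)
    eqa : ∀ B C z → (+ 0 * + 1 + B * + 0) * + 0 + (+ 0 * z + B * + 1) * - C - + 1 ≡ + 1 * (+ 0 * + 0 - B * C - + 1)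
    eqa = solve-∀
    eqb : ∀ B z → (+ 0 * + 1 + B * + 0) * - B + (+ 0 * z + B * + 1) * + 0 ≡ + 0
    eqb = solve-∀
    eqc : ∀ C z → (C * + 1 + + 0 * + 0) * + 0 + (C * z + + 0 * + 1) * - C ≡ - (C * C * z)
    eqc = solve-∀
    eqd : ∀ B C z → (C * + 1 + + 0 * + 0) * - B + (C * z + + 0 * + 1) * + 0 - + 1 ≡ + 1 * (+ 0 * + 0 - B * C - + 1)
    eqd = solve-∀

module Projective (p : ℕ) (p-prime : Prime p) where

  open Congruence p p-prime
  open Matrices p p-prime
  open import Defs
  open import Data.List.Relation.Unary.Any using (Any; here)

  infix 4 _≈ₚ_
  _≈ₚ_ : Mat → Mat → Set
  _≈ₚ_ = _≈_ p

  to≡ₚ : ∀ {x y} → x ≋ y → _≡ₚ_ p x y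
  to≡ₚ x≋y = ∣⇒∣ᵤ (divides-difference x≋y)

  from≡ₚ : ∀ {x y} → _≡ₚ_ p x y → x ≋ y
  from≡ₚ x≡y = congruent (∣ᵤ⇒∣ x≡y)

  ≋ₘ⇒≈ : ∀ {g h} → g ≋ₘ h → g ≈ₚ h
  ≋ₘ⇒≈ (entrywise ea eb ec ed) = inj₁ (to≡ₚ ea , to≡ₚ eb , to≡ₚ ec , to≡ₚ ed)

  ≋ₘ-negate⇒≈ : ∀ {g h} → g ≋ₘ negate h → g ≈ₚ h
  ≋ₘ-negate⇒≈ (entrywise ea eb ec ed) = inj₂ (to≡ₚ ea , to≡ₚ eb , to≡ₚ ec , to≡ₚ ed)

  ≈⇒≋ₘ± : ∀ {g h} → g ≈ₚ h → g ≋ₘ h ⊎ g ≋ₘ negate h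
  ≈⇒≋ₘ± (inj₁ (ea , eb , ec , ed)) = inj₁ (entrywise (from≡ₚ ea) (from≡ₚ eb) (from≡ₚ ec) (from≡ₚ ed))
  ≈⇒≋ₘ± (inj₂ (ea , eb , ec , ed)) = inj₂ (entrywise (from≡ₚ ea) (from≡ₚ eb) (from≡ₚ ec) (from≡ₚ ed))

  ≈-respˡ : ∀ {g g′ h} → g ≋ₘ g′ → g ≈ₚ h → g′ ≈ₚ h
  ≈-respˡ g≋g′ g≈h with ≈⇒≋ₘ± g≈h
  ... | inj₁ g≋h = ≋ₘ⇒≈ (≋ₘ-trans (≋ₘ-sym g≋g′) g≋h)
  ... | inj₂ g≋-h = ≋ₘ-negate⇒≈ (≋ₘ-trans (≋ₘ-sym g≋g′) g≋-h)

  ≈-refl : ∀ g → g ≈ₚ g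
  ≈-refl g = ≋ₘ⇒≈ (≋ₘ-refl {g})

  here-≈ : ∀ {g S} → Any (g ≈ₚ_) (g ∷ S)
  here-≈ {g} = here (≈-refl g)

  generator : ∀ {S} g → Any (g ≈ₚ_) S → ⟨_⟩ p S g
  generator g = gen

  ≈I⇒off-diagonal : ∀ {g} → g ≈ₚ I → + p ∣ b g × + p ∣ c g
  ≈I⇒off-diagonal {g} g≈I with ≈⇒≋ₘ± {g} {I} g≈I
  ... | inj₁ (entrywise _ eb ec _) = ≋0⇒∣ eb , ≋0⇒∣ ec
  ... | inj₂ (entrywise _ eb ec _) = ≋0⇒∣ eb , ≋0⇒∣ ec

  minor : ∀ {x x′ y y′} → (x ≋ x′ × y ≋ y′) ⊎ (x ≋ - x′ × y ≋ - y′) → + p ∣ x * y′ - y * x′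
  minor {x} {x′} {y} {y′} (inj₁ (congruent p∣x-x′ , congruent p∣y-y′)) =
    ∣-by (eq x x′ y y′) (∣m∣n⇒∣m-n (∣m⇒∣m*n y′ p∣x-x′) (∣m⇒∣m*n x′ p∣y-y′))
    where eq : ∀ x x′ y y′ → (x - x′) * y′ - (y - y′) * x′ ≡ x * y′ - y * x′
          eq = solve-∀
  minor {x} {x′} {y} {y′} (inj₂ (congruent p∣x+x′ , congruent p∣y+y′)) =
    ∣-by (eq x x′ y y′) (∣m∣n⇒∣m-n (∣m⇒∣m*n y′ p∣x+x′) (∣m⇒∣m*n x′ p∣y+y′))
    where eq : ∀ x x′ y y′ → (x - - x′) * y′ - (y - - y′) * x′ ≡ x * y′ - y * x′
          eq = solve-∀

  ≈⇒ab-minor : ∀ {g h} → g ≈ₚ h → + p ∣ a g * b h - b g * a h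
  ≈⇒ab-minor {g} {h} g≈h with ≈⇒≋ₘ± {g} {h} g≈h
  ... | inj₁ (entrywise ea eb _ _) = minor (inj₁ (ea , eb))
  ... | inj₂ (entrywise ea eb _ _) = minor (inj₂ (ea , eb))

  ≈⇒ac-minor : ∀ {g h} → g ≈ₚ h → + p ∣ a g * c h - c g * a h
  ≈⇒ac-minor {g} {h} g≈h with ≈⇒≋ₘ± {g} {h} g≈h
  ... | inj₁ (entrywise ea _ ec _) = minor (inj₁ (ea , ec))
  ... | inj₂ (entrywise ea _ ec _) = minor (inj₂ (ea , ec))

  distinct-by-ab-minor : ∀ g h → ¬ + p ∣ a g * b h - b g * a h → ¬ g ≈ₚ h
  distinct-by-ab-minor g h minor≢0 = minor≢0 ∘ ≈⇒ab-minor {g} {h}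

  distinct-by-ac-minor : ∀ g h → ¬ + p ∣ a g * c h - c g * a h → ¬ g ≈ₚ h
  distinct-by-ac-minor g h minor≢0 = minor≢0 ∘ ≈⇒ac-minor {g} {h}

  hasOrder-resp : ∀ {g h n} → g ≋ₘ h → HasOrder p h n → HasOrder p g n
  hasOrder-resp {n = n} g≋h (1≤n , hⁿ≈I , minimal) =
    1≤n , ≈-respˡ {h = I} (≋ₘ-sym (^-cong n g≋h)) hⁿ≈I ,
    λ m 1≤m m<n gᵐ≈I → minimal m 1≤m m<n (≈-respˡ {h = I} (^-cong m g≋h) gᵐ≈I)

  hasOrder-two : ∀ {g} → (g ^ 2) ≈ₚ I → ¬ + p ∣ b g ⊎ ¬ + p ∣ c g → HasOrder p g 2
  hasOrder-two {g} g²≈I off-diagonal-unit = s≤s z≤n , g²≈I , g≉I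
    where
    g≉I : ∀ m → 1 ℕ.≤ m → m ℕ.< 2 → ¬ (g ^ m) ≈ₚ I
    g≉I 1 _ _ g¹≈I = [ (λ b≢0 → b≢0 (proj₁ p∣b,c)) , (λ c≢0 → c≢0 (proj₂ p∣b,c)) ]′ off-diagonal-unit
      where p∣b,c = ≈I⇒off-diagonal {g} (≈-respˡ {h = I} (·-identityʳ g) g¹≈I)
    g≉I (suc (suc m)) _ (s≤s (s≤s ()))

  upper-order : HasOrder p (upper (+ 1)) p
  upper-order = ℕ.<⇒≤ 1<p , ≋ₘ⇒≈ (≋ₘ-trans (upper-power p) (entrywise ≋-refl (∣⇒≋0 ∣-refl) ≋-refl ≋-refl)) ,
    λ m 1≤m m<p uᵐ≈I →
      small-unit 1≤m m<p (proj₁ (≈I⇒off-diagonal {upper (+ m)} (≈-respˡ {h = I} (upper-power m) uᵐ≈I)))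

  scaled-det : ∀ s R → s * s * det R ≋ + 1 → InSL p (scale s R)
  scaled-det s R s²detR≋1 = to≡ₚ (≋-trans (≡⇒≋ (det-scale s R)) s²detR≋1)

  scaled-involution : ∀ s R k → R · R ≡ scale k I → s * s * k ≋ - + 1 → (scale s R ^ 2) ≈ₚ I
  scaled-involution s R k R²≡kI s²k≋-1 = ≋ₘ-negate⇒≈ {scale s R ^ 2} {I} (begin
    scale s R · (scale s R · I)     ≈⟨ ·-cong (≋ₘ-refl {scale s R}) (·-identityʳ (scale s R)) ⟩
    scale s R · scale s R           ≈⟨ scale-· s s R R ⟩
    scale (s * s) (R · R)           ≡⟨ cong (scale (s * s)) R²≡kI ⟩
    scale (s * s) (scale k I)       ≈⟨ scale-scale (s * s) k I ⟩
    scale (s * s * k) I             ≈⟨ scale-≋-1 I s²k≋-1 ⟩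
    negate I                        ∎)
    where open SetoidReasoning ≋ₘ-setoid

  scaled-anticommute : ∀ s t R R′ → R · R′ ≡ negate (R′ · R) → (scale s R · scale t R′) ≈ₚ (scale t R′ · scale s R)
  scaled-anticommute s t R R′ RR′≡-R′R = ≋ₘ-negate⇒≈ (begin
    scale s R · scale t R′           ≈⟨ scale-· s t R R′ ⟩
    scale (s * t) (R · R′)           ≡⟨ cong (scale (s * t)) RR′≡-R′R ⟩
    scale (s * t) (negate (R′ · R))  ≈⟨ scale-negate (s * t) (R′ · R) ⟩
    negate (scale (s * t) (R′ · R))  ≈⟨ negate-cong (scale-comm s t (R′ · R)) ⟩
    negate (scale (t * s) (R′ · R))  ≈⟨ negate-cong (scale-· t s R′ R) ⟨
    negate (scale t R′ · scale s R)  ∎)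
    where open SetoidReasoning ≋ₘ-setoid

module Generation (p : ℕ) (p-prime : Prime p) (S : List Mat) where

  open Congruence p p-prime
  open Fermat p p-prime using (inverse)
  open Matrices p p-prime
  open Projective p p-prime
  open import Defs

  Member : Mat → Set
  Member = ⟨_⟩ p S

  member-resp : ∀ {g h} → g ≋ₘ h → Member g → Member h
  member-resp g≋h = resp (≋ₘ⇒≈ g≋h)

  member-^ : ∀ {g} → Member g → ∀ n → Member (g ^ n)
  member-^ g∈ zero = one
  member-^ g∈ (suc n) = mul g∈ (member-^ g∈ n)

  upper-member : Member (upper (+ 1)) → ∀ y → Member (upper y)
  upper-member u∈ (+ n) = member-resp (upper-power n) (member-^ u∈ n)
  upper-member u∈ -[1+ n ] = inv (upper-member u∈ (+ suc n))

  -- Upper unipotents on both sides make g antidiagonal, and conjugating by an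
  -- antidiagonal matrix turns upper unipotents into lower ones.
  lower-member : Member (upper (+ 1)) → ∀ {g} → Member g → det g ≋ + 1 → ¬ + p ∣ c g → ∀ y → Member (lower y)
  lower-member u∈ {mat a b c d} g∈ det≋1 c≢0 y =
    member-resp (≋ₘ-trans (antidiagonal-conjugate z (antidiagonalise {a} {b} {c} {d} cci≋1) detM≋1) lower-entry)
      (mul (mul M∈ (upper-member u∈ z)) (inv M∈))
    where
    ci = proj₁ (inverse c≢0)
    cci≋1 = proj₂ (inverse c≢0)
    M = (upper (- (a * ci)) · mat a b c d) · upper (- (d * ci))
    M∈ : Member M
    M∈ = mul (mul (upper-member u∈ (- (a * ci))) g∈) (upper-member u∈ (- (d * ci)))
    detM≋1 : det M ≋ + 1
    detM≋1 = ≋-trans (≡⇒≋ (det-upper-sandwich (- (a * ci)) (- (d * ci)) (mat a b c d))) det≋1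
    z = - (y * ci * ci)
    lower-entry : lower (- (c * c * z)) ≋ₘ lower y
    lower-entry =
      entrywise ≋-refl ≋-refl (≋-by-multiple (y * (c * ci + + 1)) (eq c y ci) (divides-difference cci≋1)) ≋-refl
      where eq : ∀ c y ci → - (c * c * - (y * ci * ci)) - y ≡ y * (c * ci + + 1) * (c * ci - + 1)
            eq = solve-∀

  member-of-unit-c : (∀ y → Member (upper y)) → (∀ y → Member (lower y)) →
    ∀ {g} → det g ≋ + 1 → ¬ + p ∣ c g → Member g
  member-of-unit-c U∈ L∈ {mat a b c d} det≋1 c≢0 =
    member-resp (unipotent-decomposition {a} {b} {c} {d} {ci} (proj₂ (inverse c≢0)) det≋1)
      (mul (mul (U∈ ((a - + 1) * ci)) (L∈ c)) (U∈ ((d - + 1) * ci)))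
    where ci = proj₁ (inverse c≢0)

  member-all : (∀ y → Member (upper y)) → (∀ y → Member (lower y)) → Generates p S
  member-all U∈ L∈ (mat a b c d) det≡ₚ1 with + p ∣? c
  ... | no c≢0 = member-of-unit-c U∈ L∈ (from≡ₚ det≡ₚ1) c≢0
  ... | yes p∣c = member-resp (lower-shear (mat a b c d))
                    (mul (L∈ (- + 1)) (member-of-unit-c U∈ L∈ {lower (+ 1) · mat a b c d} det≋1 a+c≢0))
    where
    det≋1 : det (lower (+ 1) · mat a b c d) ≋ + 1
    det≋1 = ≋-trans (≡⇒≋ (det-lower-· (+ 1) (mat a b c d))) (from≡ₚ det≡ₚ1)
    p∣a : + p ∣ + 1 * a + + 1 * c → + p ∣ a
    p∣a p∣a+c = ∣-by (eq a c) (∣m∣n⇒∣m-n p∣a+c p∣c)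
      where eq : ∀ a c → + 1 * a + + 1 * c - c ≡ a
            eq = solve-∀
    a+c≢0 : ¬ + p ∣ + 1 * a + + 1 * c
    a+c≢0 p∣a+c = ≋1⇒unit (from≡ₚ det≡ₚ1) (∣m∣n⇒∣m-n (∣m⇒∣m*n d (p∣a p∣a+c)) (∣n⇒∣m*n b p∣c))

  generates : Member (upper (+ 1)) → ∀ {g} → Member g → InSL p g → ¬ + p ∣ c g → Generates p S
  generates u∈ g∈ g∈SL c≢0 = member-all (upper-member u∈) (lower-member u∈ g∈ (from≡ₚ g∈SL) c≢0)

module Construction (p : ℕ) (p-prime : Prime p) (2≢0 : ¬ + p ∣ + 2)
                    (i x : ℤ) (p∣i²+1 : + p ∣ i * i + + 1) (p∣3x²-1 : + p ∣ + 3 * (x * x) - + 1) where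

  open Congruence p p-prime
  open Matrices p p-prime
  open Projective p p-prime
  open import Defs
  open import Data.List.Relation.Unary.Any using (there)

  R₀ R₁ R₂ R₃ : Mat
  R₀ = mat (- + 1) (+ 0) (+ 1) (+ 1)
  R₁ = mat (+ 1) (+ 1) (+ 0) (- + 1)
  R₂ = mat (- + 1) (- + 2) (+ 0) (+ 1)
  R₃ = mat (+ 1) (+ 2) (- + 2) (- + 1)

  -- Each ρₖ is a scalar multiple of the integer matrix Rₖ, the scalar making the determinant 1
  -- (det Rₖ = −1 for k ≤ 2 and det R₃ = 3), so relations among the ρₖ reduce to computations with the Rₖ.
  ρ₀ ρ₁ ρ₂ ρ₃ : Mat
  ρ₀ = scale i R₀
  ρ₁ = scale i R₁
  ρ₂ = scale i R₂
  ρ₃ = scale x R₃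

  i²≋-1 : i * i ≋ - + 1
  i²≋-1 = congruent p∣i²+1

  3x²≋1 : + 3 * (x * x) ≋ + 1
  3x²≋1 = congruent p∣3x²-1

  i≢0 : ¬ + p ∣ i
  i≢0 p∣i = unit-by-≋ i²≋-1 (unit-neg 1≢0) (∣n⇒∣m*n i p∣i)

  x≢0 : ¬ + p ∣ x
  x≢0 p∣x = ≋1⇒unit 3x²≋1 (∣n⇒∣m*n (+ 3) (∣n⇒∣m*n x p∣x))

  i²≢0 : ¬ + p ∣ i * i
  i²≢0 = unit-* i≢0 i≢0

  2ix≢0 : ¬ + p ∣ + 2 * (i * x)
  2ix≢0 = unit-* 2≢0 (unit-* i≢0 x≢0)

  i²·-1≋1 : i * i * - + 1 ≋ + 1
  i²·-1≋1 = *-cong {i * i} { - + 1} { - + 1} { - + 1} i²≋-1 ≋-refl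

  x²·3≋1 : x * x * + 3 ≋ + 1
  x²·3≋1 = ≋-trans (≡⇒≋ (ℤ.*-comm (x * x) (+ 3))) 3x²≋1

  x²·-3≋-1 : x * x * - + 3 ≋ - + 1
  x²·-3≋-1 = ≋-trans (≡⇒≋ (sym (ℤ.neg-distribʳ-* (x * x) (+ 3)))) (-‿cong x²·3≋1)

  cρ₀≢0 : ¬ + p ∣ c ρ₀
  cρ₀≢0 = unit-by-≡ (ℤ.*-identityʳ i) i≢0

  cρ₃≢0 : ¬ + p ∣ c ρ₃
  cρ₃≢0 = unit-by-≡ (eq x) (unit-neg (unit-* 2≢0 x≢0))
    where eq : ∀ x → x * - + 2 ≡ - (+ 2 * x)
          eq = solve-∀

  ρ-SL : InSL p ρ₀ × InSL p ρ₁ × InSL p ρ₂ × InSL p ρ₃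
  ρ-SL = scaled-det i R₀ i²·-1≋1 , scaled-det i R₁ i²·-1≋1 , scaled-det i R₂ i²·-1≋1 , scaled-det x R₃ x²·3≋1

  ρ-involutions : HasOrder p ρ₀ 2 × HasOrder p ρ₁ 2 × HasOrder p ρ₂ 2 × HasOrder p ρ₃ 2
  ρ-involutions =
    hasOrder-two (scaled-involution i R₀ (+ 1) refl i²·1≋-1) (inj₂ cρ₀≢0) ,
    hasOrder-two (scaled-involution i R₁ (+ 1) refl i²·1≋-1) (inj₁ (unit-by-≡ (ℤ.*-identityʳ i) i≢0)) ,
    hasOrder-two (scaled-involution i R₂ (+ 1) refl i²·1≋-1)
                 (inj₁ (unit-by-≡ (eq i) (unit-neg (unit-* 2≢0 i≢0)))) ,
    hasOrder-two (scaled-involution x R₃ (- + 3) refl x²·-3≋-1) (inj₂ cρ₃≢0)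
    where
    i²·1≋-1 : i * i * + 1 ≋ - + 1
    i²·1≋-1 = ≋-trans (≡⇒≋ (ℤ.*-identityʳ (i * i))) i²≋-1
    eq : ∀ i → i * - + 2 ≡ - (+ 2 * i)
    eq = solve-∀

  ρ-distinct : ¬ ρ₀ ≈ₚ ρ₁ × ¬ ρ₀ ≈ₚ ρ₂ × ¬ ρ₀ ≈ₚ ρ₃ × ¬ ρ₁ ≈ₚ ρ₂ × ¬ ρ₁ ≈ₚ ρ₃ × ¬ ρ₂ ≈ₚ ρ₃
  ρ-distinct =
    distinct-by-ac-minor ρ₀ ρ₁ (unit-by-≡ (e₀₁ i) (unit-neg i²≢0)) ,
    distinct-by-ac-minor ρ₀ ρ₂ (unit-by-≡ (e₀₂ i) i²≢0) ,
    distinct-by-ab-minor ρ₀ ρ₃ (unit-by-≡ (e₀₃ i x) (unit-neg 2ix≢0)) ,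
    distinct-by-ab-minor ρ₁ ρ₂ (unit-by-≡ (e₁₂ i) (unit-neg i²≢0)) ,
    distinct-by-ac-minor ρ₁ ρ₃ (unit-by-≡ (e₁₃ i x) (unit-neg 2ix≢0)) ,
    distinct-by-ac-minor ρ₂ ρ₃ (unit-by-≡ (e₂₃ i x) 2ix≢0)
    where
    e₀₁ : ∀ i → i * - + 1 * (i * + 0) - i * + 1 * (i * + 1) ≡ - (i * i)
    e₀₁ = solve-∀
    e₀₂ : ∀ i → i * - + 1 * (i * + 0) - i * + 1 * (i * - + 1) ≡ i * i
    e₀₂ = solve-∀
    e₀₃ : ∀ i x → i * - + 1 * (x * + 2) - i * + 0 * (x * + 1) ≡ - (+ 2 * (i * x))
    e₀₃ = solve-∀
    e₁₂ : ∀ i → i * + 1 * (i * - + 2) - i * + 1 * (i * - + 1) ≡ - (i * i)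
    e₁₂ = solve-∀
    e₁₃ : ∀ i x → i * + 1 * (x * - + 2) - i * + 0 * (x * + 1) ≡ - (+ 2 * (i * x))
    e₁₃ = solve-∀
    e₂₃ : ∀ i x → i * - + 1 * (x * - + 2) - i * + 0 * (x * + 1) ≡ + 2 * (i * x)
    e₂₃ = solve-∀

  ρ-commute : (ρ₀ · ρ₂) ≈ₚ (ρ₂ · ρ₀) × (ρ₀ · ρ₃) ≈ₚ (ρ₃ · ρ₀) × (ρ₁ · ρ₃) ≈ₚ (ρ₃ · ρ₁)
  ρ-commute =
    scaled-anticommute i i R₀ R₂ refl , scaled-anticommute i x R₀ R₃ refl , scaled-anticommute i x R₁ R₃ refl

  ρ₁ρ₂≋upper : ρ₁ · ρ₂ ≋ₘ upper (+ 1)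
  ρ₁ρ₂≋upper = scaled-product i i R₁ R₂ i²≋-1

  W : Mat
  W = negate (R₀ · R₁)

  ρ₀ρ₁≋W : ρ₀ · ρ₁ ≋ₘ W
  ρ₀ρ₁≋W = scaled-product i i R₀ R₁ i²≋-1

  W-order : HasOrder p W 3
  W-order = s≤s z≤n , ≋ₘ-negate⇒≈ {W ^ 3} {I} ≋ₘ-refl , W≉I
    where
    W≉I : ∀ m → 1 ℕ.≤ m → m ℕ.< 3 → ¬ (W ^ m) ≈ₚ I
    W≉I 1 _ _ W≈I = unit-neg 1≢0 (proj₂ (≈I⇒off-diagonal {W ^ 1} W≈I))
    W≉I 2 _ _ W²≈I = unit-neg 1≢0 (proj₂ (≈I⇒off-diagonal {W ^ 2} W²≈I))
    W≉I (suc (suc (suc m))) _ (s≤s (s≤s (s≤s ())))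

  ρ₀ρ₁-order : HasOrder p (ρ₀ · ρ₁) 3
  ρ₀ρ₁-order = hasOrder-resp ρ₀ρ₁≋W W-order

  ρ₁ρ₂-order : HasOrder p (ρ₁ · ρ₂) p
  ρ₁ρ₂-order = hasOrder-resp ρ₁ρ₂≋upper upper-order

  generated-by : ∀ S {g} → ⟨_⟩ p S (ρ₁ · ρ₂) → ⟨_⟩ p S g → InSL p g → ¬ + p ∣ c g → Generates p S
  generated-by S ρ₁ρ₂∈ = generates (member-resp ρ₁ρ₂≋upper ρ₁ρ₂∈)
    where open Generation p p-prime S

  ρ-generate : Generates p (ρ₀ ∷ ρ₁ ∷ ρ₂ ∷ ρ₃ ∷ [])
  ρ-generate = generated-by _
    (mul (generator ρ₁ (there here-≈)) (generator ρ₂ (there (there here-≈))))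
    (generator ρ₀ here-≈) (proj₁ ρ-SL) cρ₀≢0

  ρ₀ρ₁ρ₂-generate : Generates p (ρ₀ ∷ ρ₁ ∷ ρ₂ ∷ [])
  ρ₀ρ₁ρ₂-generate = generated-by _
    (mul (generator ρ₁ (there here-≈)) (generator ρ₂ (there (there here-≈))))
    (generator ρ₀ here-≈) (proj₁ ρ-SL) cρ₀≢0

  ρ₁ρ₂ρ₃-generate : Generates p (ρ₁ ∷ ρ₂ ∷ ρ₃ ∷ [])
  ρ₁ρ₂ρ₃-generate = generated-by _
    (mul (generator ρ₁ here-≈) (generator ρ₂ (there here-≈)))
    (generator ρ₃ (there (there here-≈))) (proj₂ (proj₂ (proj₂ ρ-SL))) cρ₃≢0

  products-generate : NonOrientable4 p ρ₀ ρ₁ ρ₂ ρ₃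
  products-generate = generated-by _
    (generator (ρ₁ · ρ₂) (there (there (there (there here-≈)))))
    (generator (ρ₀ · ρ₁) here-≈) (to≡ₚ (det-cong ρ₀ρ₁≋W)) (unit-by-≋ (≋c ρ₀ρ₁≋W) (unit-neg 1≢0))

open import Defs

mainTheorem8 : (p : ℕ) → Prime p → p % 12 ≡ 1 →
    ∃ λ ρ₀ → ∃ λ ρ₁ → ∃ λ ρ₂ → ∃ λ ρ₃ →
        IsStringRep4 p ρ₀ ρ₁ ρ₂ ρ₃
      × NonOrientable4 p ρ₀ ρ₁ ρ₂ ρ₃
      × Generates p (ρ₀ ∷ ρ₁ ∷ ρ₂ ∷ [])
      × Generates p (ρ₁ ∷ ρ₂ ∷ ρ₃ ∷ [])
      × HasOrder p (ρ₀ · ρ₁) 3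
      × HasOrder p (ρ₁ · ρ₂) p
mainTheorem8 p p-prime p%12≡1 =
  ρ₀ , ρ₁ , ρ₂ , ρ₃ ,
  (ρ-SL , ρ-involutions , ρ-distinct , ρ-commute , ρ-generate) ,
  products-generate , ρ₀ρ₁ρ₂-generate , ρ₁ρ₂ρ₃-generate , ρ₀ρ₁-order , ρ₁ρ₂-order
  where
  open Congruence p p-prime
  open Roots p p-prime
  m = p / 12
  p≡1+12m : p ≡ suc (12 ℕ.* m)
  p≡1+12m = trans (m≡m%n+[m/n]*n p 12) (cong₂ ℕ._+_ p%12≡1 (ℕ.*-comm m 12))
  i = sqrt-minus-one (3 ℕ.* m) (trans p≡1+12m (cong suc (ℕ.*-assoc 4 3 m)))
  x = sqrt-one-third m p≡1+12m
  2≢0 = small-unit (s≤s z≤n) (ℕ.≤-trans (ℕ.m≤m+n 3 10) (13≤p m p≡1+12m))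
  open Construction p p-prime 2≢0 (proj₁ i) (proj₁ x)
    (divides-difference (proj₂ i)) (divides-difference (proj₂ x))
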